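{- Let $c,k$ be positive integers and $G$ a graph. Construct an instance $(U,\mathcal{A},k)$ of \textsc{$(c+2)$-Hitting Set} as follows: $U=V(G)$; for every bad pair $\{u,v\}$ of $G$: if $u$ and $v$ have fewer than $k+c$ common neighbors, then for every FSG of $G$ with bad pair $\{u,v\}$ add its vertex set to $\mathcal{A}$; otherwise choose an arbitrary set $C$ of exactly $k+c$ common neighbors of $u$ and $v$, and for every FSG of $G$ with bad pair $\{u,v\}$ all of whose connecting vertices lie in $C$, add its vertex set to $\mathcal{A}$. Then $(G,k)$ is a yes-instance of \textsc{$c$-Closed Vertex Deletion} if and only if $(U,\mathcal{A},k)$ is a yes-instance of \textsc{$(c+2)$-Hitting Set}.
   Context: A graph is $c$-closed if every pair of distinct nonadjacent vertices has at most $c-1$ common neighbors. \textsc{$c$-Closed Vertex Deletion}: given a graph $G=(V,E)$ and a positive integer $k$, decide whether there is $S\subseteq V$ with $|S|\le k$ such that $G-S$ is $c$-closed. A bad pair is a pair of distinct nonadjacent vertices with at least $c$ common neighbors. An FSG (minimal forbidden subgraph) with bad pair $\{u,v\}$ is the subgraph of $G$ induced by $u$, $v$ and exactly $c$ common neighbors of $u$ and $v$ (its connecting vertices). \textsc{$d$-Hitting Set}: given a family $\mathcal{A}$ of subsets of a universe $U$, each of size at most $d$, and a positive integer $k$, decide whether there is $H\subseteq U$ with $|H|\le k$ intersecting every set of $\mathcal{A}$. -}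

module Defs where

open import Data.Nat using (ℕ; _≤_; _<_; _+_)
open import Data.Bool using (Bool; true; false)
open import Data.Fin using (Fin)
open import Data.Fin.Subset using (Subset; _∈_; _∉_; _⊆_; _∩_; _∪_; ⁅_⁆; ∁; ∣_∣; Nonempty)
open import Data.Vec using (tabulate)
open import Data.Product using (Σ; ∃; ∃-syntax; _×_)
open import Data.Sum using (_⊎_)
open import Relation.Binary.PropositionalEquality using (_≡_; _≢_)

record Graph (n : ℕ) : Set where
  field
    adj    : Fin n → Fin n → Bool
    sym    : ∀ u v → adj u v ≡ adj v u
    irrefl : ∀ u → adj u u ≡ false
open Graph public

module _ {n : ℕ} (G : Graph n) where

  N : Fin n → Subset n
  N u = tabulate (λ w → adj G u w)

  CN : Fin n → Fin n → Subset n
  CN u v = N u ∩ N v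

  BadPair : ℕ → Fin n → Fin n → Set
  BadPair c u v = u ≢ v × adj G u v ≡ false × c ≤ ∣ CN u v ∣

  ClosedAfterDeletion : ℕ → Subset n → Set
  ClosedAfterDeletion c S =
    ∀ u v → u ∉ S → v ∉ S → u ≢ v → adj G u v ≡ false →
    ∣ CN u v ∩ ∁ S ∣ < c

  CCVD-Yes : ℕ → ℕ → Set
  CCVD-Yes c k = ∃[ S ] (∣ S ∣ ≤ k × ClosedAfterDeletion c S)

  record Choice (c k : ℕ) : Set where
    field
      C      : Fin n → Fin n → Subset n
      C-sym  : ∀ u v → C u v ≡ C v u
      C-sub  : ∀ u v → BadPair c u v → k + c ≤ ∣ CN u v ∣ → C u v ⊆ CN u v
      C-size : ∀ u v → BadPair c u v → k + c ≤ ∣ CN u v ∣ → ∣ C u v ∣ ≡ k + c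
  open Choice public

  -- The constructed family 𝒜 (as a predicate on subsets of U = V(G)):
  -- X ∈ 𝒜 iff X is the vertex set {u,v} ∪ D of an FSG with bad pair {u,v}
  -- and connecting vertices D (exactly c common neighbours), where, if u,v
  -- have at least k+c common neighbours, D ⊆ C(u,v).
  Family : (c k : ℕ) → Choice c k → Subset n → Set
  Family c k ch X =
    ∃[ u ] ∃[ v ] ∃[ D ]
      ( BadPair c u v
      × D ⊆ CN u v
      × ∣ D ∣ ≡ c
      × X ≡ (⁅ u ⁆ ∪ ⁅ v ⁆) ∪ D
      × (∣ CN u v ∣ < k + c ⊎ D ⊆ C ch u v) )

ValidHS : {n : ℕ} → ℕ → (Subset n → Set) → Set
ValidHS d 𝒜 = ∀ X → 𝒜 X → ∣ X ∣ ≤ d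

HS-Yes : {n : ℕ} → (Subset n → Set) → ℕ → Set
HS-Yes 𝒜 k = ∃[ H ] (∣ H ∣ ≤ k × (∀ X → 𝒜 X → Nonempty (H ∩ X)))

-- A hitting set H with ∣ H ∣ ≤ k avoids at least c of the k + c vertices of C(u,v), so if
-- u, v ∉ H then some FSG with connecting vertices in C(u,v) still misses H: restricting a
-- bad pair with many common neighbours to the FSGs inside C(u,v) loses no obstruction.
-- Conversely, a deletion set missing an FSG would leave its bad pair bad after deletion.
module Submission where

open import Defs
open import Data.Nat using (ℕ; suc; _+_; _≤_)
open import Data.Product using (_×_)
open import Function.Bundles using (_⇔_)

open import Data.Nat using (z≤n; s≤s; _≤?_)
open import Data.Nat.Properties
open import Data.Bool using (true; false)
open import Data.Fin using (Fin)
open import Data.Vec using ([]; _∷_)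
open import Data.Fin.Subset renaming (⊥ to ∅)
open import Data.Fin.Subset.Properties
open import Data.Product using (_,_; ∃-syntax)
open import Data.Sum using (inj₁; inj₂; [_,_])
open import Relation.Nullary using (yes; no; contradiction)
open import Relation.Binary.PropositionalEquality
  using (_≡_; refl; cong; cong₂; subst) renaming (sym to ≡-sym)
open import Function.Bundles using (mk⇔)

private variable
  m : ℕ

∣p∪q∣≤∣p∣+∣q∣ : (p q : Subset m) → ∣ p ∪ q ∣ ≤ ∣ p ∣ + ∣ q ∣
∣p∪q∣≤∣p∣+∣q∣ []          []          = z≤n
∣p∪q∣≤∣p∣+∣q∣ (true ∷ p)  (true ∷ q)  =
  s≤s (≤-trans (∣p∪q∣≤∣p∣+∣q∣ p q) (+-monoʳ-≤ ∣ p ∣ (n≤1+n ∣ q ∣)))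
∣p∪q∣≤∣p∣+∣q∣ (true ∷ p)  (false ∷ q) = s≤s (∣p∪q∣≤∣p∣+∣q∣ p q)
∣p∪q∣≤∣p∣+∣q∣ (false ∷ p) (true ∷ q)  =
  ≤-trans (s≤s (∣p∪q∣≤∣p∣+∣q∣ p q)) (≤-reflexive (≡-sym (+-suc ∣ p ∣ ∣ q ∣)))
∣p∪q∣≤∣p∣+∣q∣ (false ∷ p) (false ∷ q) = ∣p∪q∣≤∣p∣+∣q∣ p q

∣p∣≤∣p∩∁q∣+∣q∣ : (p q : Subset m) → ∣ p ∣ ≤ ∣ p ∩ ∁ q ∣ + ∣ q ∣
∣p∣≤∣p∩∁q∣+∣q∣ []          []          = z≤n
∣p∣≤∣p∩∁q∣+∣q∣ (true ∷ p)  (true ∷ q)  =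
  ≤-trans (s≤s (∣p∣≤∣p∩∁q∣+∣q∣ p q)) (≤-reflexive (≡-sym (+-suc ∣ p ∩ ∁ q ∣ ∣ q ∣)))
∣p∣≤∣p∩∁q∣+∣q∣ (true ∷ p)  (false ∷ q) = s≤s (∣p∣≤∣p∩∁q∣+∣q∣ p q)
∣p∣≤∣p∩∁q∣+∣q∣ (false ∷ p) (true ∷ q)  =
  ≤-trans (∣p∣≤∣p∩∁q∣+∣q∣ p q) (+-monoʳ-≤ ∣ p ∩ ∁ q ∣ (n≤1+n ∣ q ∣))
∣p∣≤∣p∩∁q∣+∣q∣ (false ∷ p) (false ∷ q) = ∣p∣≤∣p∩∁q∣+∣q∣ p q

c≤∣p∩∁q∣ : ∀ {c k} (p q : Subset m) → ∣ q ∣ ≤ k → k + c ≤ ∣ p ∣ → c ≤ ∣ p ∩ ∁ q ∣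
c≤∣p∩∁q∣ {c = c} {k} p q ∣q∣≤k k+c≤∣p∣ = +-cancelˡ-≤ k c ∣ p ∩ ∁ q ∣ (begin
  k + c                 ≤⟨ k+c≤∣p∣ ⟩
  ∣ p ∣                 ≤⟨ ∣p∣≤∣p∩∁q∣+∣q∣ p q ⟩
  ∣ p ∩ ∁ q ∣ + ∣ q ∣   ≤⟨ +-monoʳ-≤ ∣ p ∩ ∁ q ∣ ∣q∣≤k ⟩
  ∣ p ∩ ∁ q ∣ + k       ≡⟨ +-comm ∣ p ∩ ∁ q ∣ k ⟩
  k + ∣ p ∩ ∁ q ∣       ∎)
  where open ≤-Reasoning

⊆-ofSize : ∀ c (p : Subset m) → c ≤ ∣ p ∣ → ∃[ d ] (d ⊆ p × ∣ d ∣ ≡ c)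
⊆-ofSize c       (false ∷ p) c≤∣p∣ with ⊆-ofSize c p c≤∣p∣
... | d , d⊆p , ∣d∣≡c = false ∷ d , out⊆ d⊆p , ∣d∣≡c
⊆-ofSize {m} 0   p           _     = ∅ , ⊆-min p , ∣⊥∣≡0 m
⊆-ofSize (suc c) (true ∷ p)  (s≤s c≤∣p∣) with ⊆-ofSize c p c≤∣p∣
... | d , d⊆p , ∣d∣≡c = true ∷ d , in⊆in d⊆p , cong suc ∣d∣≡c

∪-least : {p q r : Subset m} → p ⊆ r → q ⊆ r → p ∪ q ⊆ r
∪-least p⊆r q⊆r {x} x∈p∪q = [ p⊆r , q⊆r ] (x∈p∪q⁻ _ _ x∈p∪q)

⁅x⁆⊆p : {x : Fin m} {p : Subset m} → x ∈ p → ⁅ x ⁆ ⊆ p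
⁅x⁆⊆p {x = x} x∈p y∈⁅x⁆ = subst (_∈ _) (≡-sym (x∈⁅y⁆⇒x≡y x y∈⁅x⁆)) x∈p

⊆∁⇒∩-Empty : {p q : Subset m} → q ⊆ ∁ p → Empty (p ∩ q)
⊆∁⇒∩-Empty q⊆∁p (x , x∈p∩q) with x∈p∩q⁻ _ _ x∈p∩q
... | x∈p , x∈q = x∈∁p⇒x∉p (q⊆∁p x∈q) x∈p

∩-Empty⇒⊆∁ : {p q : Subset m} → Empty (p ∩ q) → q ⊆ ∁ p
∩-Empty⇒⊆∁ empty {x} x∈q = x∉p⇒x∈∁p (λ x∈p → empty (x , x∈p∩q⁺ (x∈p , x∈q)))

module _ {n : ℕ} (G : Graph n) {c k : ℕ} (ch : Choice G c k) where

  fsgVertices : Fin n → Fin n → Subset n → Subset n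
  fsgVertices u v D = (⁅ u ⁆ ∪ ⁅ v ⁆) ∪ D

  ∣fsgVertices∣≤∣D∣+2 : ∀ u v D → ∣ fsgVertices u v D ∣ ≤ ∣ D ∣ + 2
  ∣fsgVertices∣≤∣D∣+2 u v D = begin
    ∣ (⁅ u ⁆ ∪ ⁅ v ⁆) ∪ D ∣           ≤⟨ ∣p∪q∣≤∣p∣+∣q∣ (⁅ u ⁆ ∪ ⁅ v ⁆) D ⟩
    ∣ ⁅ u ⁆ ∪ ⁅ v ⁆ ∣ + ∣ D ∣         ≤⟨ +-monoˡ-≤ ∣ D ∣ (∣p∪q∣≤∣p∣+∣q∣ ⁅ u ⁆ ⁅ v ⁆) ⟩
    ∣ ⁅ u ⁆ ∣ + ∣ ⁅ v ⁆ ∣ + ∣ D ∣     ≡⟨ cong₂ (λ a b → a + b + ∣ D ∣) (∣⁅x⁆∣≡1 u) (∣⁅x⁆∣≡1 v) ⟩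
    2 + ∣ D ∣                          ≡⟨ +-comm 2 ∣ D ∣ ⟩
    ∣ D ∣ + 2                          ∎
    where open ≤-Reasoning

  fsgVertices⊆∁ : ∀ {H u v D} → u ∉ H → v ∉ H → D ⊆ ∁ H → fsgVertices u v D ⊆ ∁ H
  fsgVertices⊆∁ u∉H v∉H D⊆∁H =
    ∪-least (∪-least (⁅x⁆⊆p (x∉p⇒x∈∁p u∉H)) (⁅x⁆⊆p (x∉p⇒x∈∁p v∉H))) D⊆∁H

  family-valid : ValidHS (c + 2) (Family G c k ch)
  family-valid _ (u , v , D , _ , _ , ∣D∣≡c , refl , _) =
    subst (λ d → ∣ fsgVertices u v D ∣ ≤ d + 2) ∣D∣≡c (∣fsgVertices∣≤∣D∣+2 u v D)

  closed⇒hitting : ∀ {S} → ClosedAfterDeletion G c S → ∀ X → Family G c k ch X → Nonempty (S ∩ X)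
  closed⇒hitting {S} closed _ (u , v , D , (u≢v , nonadj , _) , D⊆CN , ∣D∣≡c , refl , _)
    with nonempty? (S ∩ fsgVertices u v D)
  ... | yes hit = hit
  ... | no miss = contradiction c≤∣CN∩∁S∣ (<⇒≱ (closed u v u∉S v∉S u≢v nonadj))
    where
    X⊆∁S : fsgVertices u v D ⊆ ∁ S
    X⊆∁S = ∩-Empty⇒⊆∁ miss
    u∉S : u ∉ S
    u∉S = x∈∁p⇒x∉p (X⊆∁S (p⊆p∪q D (p⊆p∪q ⁅ v ⁆ (x∈⁅x⁆ u))))
    v∉S : v ∉ S
    v∉S = x∈∁p⇒x∉p (X⊆∁S (p⊆p∪q D (q⊆p∪q ⁅ u ⁆ ⁅ v ⁆ (x∈⁅x⁆ v))))
    c≤∣CN∩∁S∣ : c ≤ ∣ CN G u v ∩ ∁ S ∣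
    c≤∣CN∩∁S∣ = subst (_≤ ∣ CN G u v ∩ ∁ S ∣) ∣D∣≡c (p⊆q⇒∣p∣≤∣q∣ λ x∈D →
      x∈p∩q⁺ (D⊆CN x∈D , X⊆∁S (q⊆p∪q (⁅ u ⁆ ∪ ⁅ v ⁆) D x∈D)))

  member-avoiding : ∀ {H u v} → ∣ H ∣ ≤ k → BadPair G c u v → u ∉ H → v ∉ H →
    c ≤ ∣ CN G u v ∩ ∁ H ∣ → ∃[ X ] (Family G c k ch X × X ⊆ ∁ H)
  member-avoiding {H} {u} {v} ∣H∣≤k bad u∉H v∉H c≤∣CN∩∁H∣ with k + c ≤? ∣ CN G u v ∣
  ... | no  few  with ⊆-ofSize c (CN G u v ∩ ∁ H) c≤∣CN∩∁H∣
  ...   | D , D⊆ , ∣D∣≡c =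
    fsgVertices u v D ,
    (u , v , D , bad , (λ x∈D → p∩q⊆p _ _ (D⊆ x∈D)) , ∣D∣≡c , refl , inj₁ (≰⇒> few)) ,
    fsgVertices⊆∁ u∉H v∉H (λ x∈D → p∩q⊆q _ _ (D⊆ x∈D))
  member-avoiding {H} {u} {v} ∣H∣≤k bad u∉H v∉H _ | yes many
    with ⊆-ofSize c (C ch u v ∩ ∁ H)
           (c≤∣p∩∁q∣ (C ch u v) H ∣H∣≤k (≤-reflexive (≡-sym (C-size ch u v bad many))))
  ...   | D , D⊆ , ∣D∣≡c =
    fsgVertices u v D ,
    (u , v , D , bad , (λ x∈D → C-sub ch u v bad many (p∩q⊆p _ _ (D⊆ x∈D))) ,
      ∣D∣≡c , refl , inj₂ (λ x∈D → p∩q⊆p _ _ (D⊆ x∈D))) ,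
    fsgVertices⊆∁ u∉H v∉H (λ x∈D → p∩q⊆q _ _ (D⊆ x∈D))

  hitting⇒closed : ∀ {H} → ∣ H ∣ ≤ k → (∀ X → Family G c k ch X → Nonempty (H ∩ X)) →
    ClosedAfterDeletion G c H
  hitting⇒closed {H} ∣H∣≤k hits u v u∉H v∉H u≢v nonadj with c ≤? ∣ CN G u v ∩ ∁ H ∣
  ... | no  c≰ = ≰⇒> c≰
  ... | yes c≤ with member-avoiding ∣H∣≤k bad u∉H v∉H c≤
    where bad = u≢v , nonadj , ≤-trans c≤ (∣p∩q∣≤∣p∣ (CN G u v) (∁ H))
  ...   | X , X∈𝒜 , X⊆∁H = contradiction (hits X X∈𝒜) (⊆∁⇒∩-Empty X⊆∁H)

lemma4 : (n c k : ℕ) → 1 ≤ c → 1 ≤ k → (G : Graph n) → (ch : Choice G c k) →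
    ValidHS (c + 2) (Family G c k ch) × (CCVD-Yes G c k ⇔ HS-Yes (Family G c k ch) k)
lemma4 n c k _ _ G ch =
  family-valid G ch ,
  mk⇔ (λ (S , ∣S∣≤k , closed) → S , ∣S∣≤k , closed⇒hitting G ch closed)
      (λ (H , ∣H∣≤k , hits)   → H , ∣H∣≤k , hitting⇒closed G ch ∣H∣≤k hits)
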